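{- Let $A$ be a finite non-empty set of agents. For all distinct agents $a,b\in A$ and every formula $\varphi\in\mathcal{L}_{KS}$, $\vdash_{\mathsf{SSL}}S_a\varphi\to K_a\neg K_b\varphi$ and $\vdash_{\mathsf{SSL}}S_a\varphi\to K_a\neg K_b\neg\varphi$.
   Context: The language $\mathcal{L}_{KS}$ over a countable set $\mathsf{Prop}$ of variables and agents $A$ is $\varphi::=p\mid\neg\varphi\mid(\varphi\wedge\varphi)\mid K_a\varphi\mid S_a\varphi$. The system $\mathsf{SSL}$ has axioms: all propositional tautologies; for each $a\in A$: (K) $K_a(\varphi\to\psi)\to(K_a\varphi\to K_a\psi)$, (T) $K_a\varphi\to\varphi$, (4) $K_a\varphi\to K_aK_a\varphi$, (5) $\neg K_a\varphi\to K_a\neg K_a\varphi$, (S1) $S_a\varphi\to K_a\varphi$, (S4) $S_a\varphi\to K_aS_a\varphi$; and for distinct $a,b\in A$: (S2) $S_a\varphi\to\neg K_b\varphi$. Rules: modus ponens; from $\varphi$ infer $K_a\varphi$; from $\vdash\varphi\leftrightarrow\psi$ infer $\vdash S_a\varphi\leftrightarrow S_a\psi$. -}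

module Defs where

open import Data.Nat using (ℕ)
open import Data.Bool using (Bool; true; false; not; _∧_)
open import Relation.Binary.PropositionalEquality using (_≡_)
open import Relation.Nullary using (¬_)

data Form (Agent : Set) : Set where
  var : ℕ → Form Agent
  ¬'_ : Form Agent → Form Agent
  _∧'_ : Form Agent → Form Agent → Form Agent
  K : Agent → Form Agent → Form Agent
  S : Agent → Form Agent → Form Agent

infixr 6 _∧'_
infixr 4 _⇒_ _⇔_

_⇒_ : {Agent : Set} → Form Agent → Form Agent → Form Agent
φ ⇒ ψ = ¬' (φ ∧' ¬' ψ)

_⇔_ : {Agent : Set} → Form Agent → Form Agent → Form Agent
φ ⇔ ψ = (φ ⇒ ψ) ∧' (ψ ⇒ φ)

eval : {Agent : Set} → (Form Agent → Bool) → Form Agent → Bool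
eval v (var p) = v (var p)
eval v (¬' φ) = not (eval v φ)
eval v (φ ∧' ψ) = eval v φ ∧ eval v ψ
eval v (K a φ) = v (K a φ)
eval v (S a φ) = v (S a φ)

-- φ is (a substitution instance of) a propositional tautology.
Tautology : {Agent : Set} → Form Agent → Set
Tautology φ = ∀ v → eval v φ ≡ true

data ⊢SSL {Agent : Set} : Form Agent → Set where
  taut : ∀ {φ} → Tautology φ → ⊢SSL φ
  axK  : ∀ a φ ψ → ⊢SSL (K a (φ ⇒ ψ) ⇒ (K a φ ⇒ K a ψ))
  axT  : ∀ a φ → ⊢SSL (K a φ ⇒ φ)
  ax4  : ∀ a φ → ⊢SSL (K a φ ⇒ K a (K a φ))
  ax5  : ∀ a φ → ⊢SSL (¬' K a φ ⇒ K a (¬' K a φ))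
  axS1 : ∀ a φ → ⊢SSL (S a φ ⇒ K a φ)
  axS4 : ∀ a φ → ⊢SSL (S a φ ⇒ K a (S a φ))
  axS2 : ∀ a b φ → ¬ (a ≡ b) → ⊢SSL (S a φ ⇒ ¬' K b φ)
  mp   : ∀ {φ ψ} → ⊢SSL (φ ⇒ ψ) → ⊢SSL φ → ⊢SSL ψ
  nec  : ∀ a {φ} → ⊢SSL φ → ⊢SSL (K a φ)
  reS  : ∀ a {φ ψ} → ⊢SSL (φ ⇔ ψ) → ⊢SSL (S a φ ⇔ S a ψ)

module Submission where

open import Defs
open import Data.Nat using (ℕ; suc)
open import Data.Fin using (Fin)
open import Data.Product using (_×_; _,_)
open import Data.Bool using (true; false)
open import Function.Bundles using (_↔_)
open import Relation.Binary.PropositionalEquality using (_≡_; refl)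
open import Relation.Nullary using (¬_)

-- By S4 and S2, S_a φ gives K_a S_a φ and K_a S_a φ entails K_a ¬K_b φ.
-- By S1, S_a φ gives K_a φ, and φ entails ¬K_b ¬φ by T, for any agent b.

module _ {Agent : Set} where

  ⇒-trans : {φ ψ χ : Form Agent} → ⊢SSL (φ ⇒ ψ) → ⊢SSL (ψ ⇒ χ) → ⊢SSL (φ ⇒ χ)
  ⇒-trans {φ} {ψ} {χ} φ⇒ψ ψ⇒χ = mp (mp (taut syllogism) φ⇒ψ) ψ⇒χ
    where
    syllogism : Tautology ((φ ⇒ ψ) ⇒ ((ψ ⇒ χ) ⇒ (φ ⇒ χ)))
    syllogism v with eval v φ | eval v ψ | eval v χ
    ... | false | false | false = refl
    ... | false | false | true  = refl
    ... | false | true  | false = refl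
    ... | false | true  | true  = refl
    ... | true  | false | false = refl
    ... | true  | false | true  = refl
    ... | true  | true  | false = refl
    ... | true  | true  | true  = refl

  ⇒¬-swap : {φ ψ : Form Agent} → ⊢SSL (φ ⇒ ¬' ψ) → ⊢SSL (ψ ⇒ ¬' φ)
  ⇒¬-swap {φ} {ψ} = mp (taut contraposition)
    where
    contraposition : Tautology ((φ ⇒ ¬' ψ) ⇒ (ψ ⇒ ¬' φ))
    contraposition v with eval v φ | eval v ψ
    ... | false | false = refl
    ... | false | true  = refl
    ... | true  | false = refl
    ... | true  | true  = refl

  K-mono : (a : Agent) {φ ψ : Form Agent} → ⊢SSL (φ ⇒ ψ) → ⊢SSL (K a φ ⇒ K a ψ)
  K-mono a {φ} {ψ} φ⇒ψ = mp (axK a φ ψ) (nec a φ⇒ψ)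

  S⇒K¬K : (a b : Agent) → ¬ (a ≡ b) → (φ : Form Agent) → ⊢SSL (S a φ ⇒ K a (¬' K b φ))
  S⇒K¬K a b a≢b φ = ⇒-trans (axS4 a φ) (K-mono a (axS2 a b φ a≢b))

  S⇒K¬K¬ : (a b : Agent) (φ : Form Agent) → ⊢SSL (S a φ ⇒ K a (¬' K b (¬' φ)))
  S⇒K¬K¬ a b φ = ⇒-trans (axS1 a φ) (K-mono a (⇒¬-swap (axT b (¬' φ))))

proposition4p6 : (Agent : Set) (n : ℕ) → Agent ↔ Fin (suc n) →
    (a b : Agent) → ¬ (a ≡ b) → (φ : Form Agent) →
    ⊢SSL (S a φ ⇒ K a (¬' K b φ)) × ⊢SSL (S a φ ⇒ K a (¬' K b (¬' φ)))
proposition4p6 Agent n _ a b a≢b φ = S⇒K¬K a b a≢b φ , S⇒K¬K¬ a b φ
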